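{- Let $m,k \geq 1$ be integers and let $T$ be the $(5mk+2)$-vertex tournament $T_{2mk+1,2mk+1,mk}$ (for any choice of the distinguished vertices $a_1,\dots,a_{mk}$, $b_1,\dots,b_{mk}$ and of the transitive ordering in its construction). Then every spanning subgraph $D$ of $T$ with $\delta^{+}(D) , \delta^{ - }(D) \geq k$ contains at least $\frac{k-2m+1}{5m}$ vertices whose in-degree or out-degree in $D$ is more than $k$.
   Context: Let $r = mk$ and $N = 2mk+1$. Let $T_2$ and $T_3$ be two disjoint copies of the tournament on vertex set $\mathbb{Z}_N$ with edges $(i, i+j)$ for $j = 1,\dots,mk$ (the $mk$-th power of a directed $N$-cycle, i.e. $u\to v$ iff the distance from $u$ to $v$ along the cycle is at most $mk$). Let $T_1$ be a transitive tournament on $r=mk$ vertices, disjoint from $T_2,T_3$. Choose distinct vertices $a_1,\dots,a_r \in V(T_2)$ and distinct $b_1,\dots,b_r\in V(T_3)$. The tournament $T_{2mk+1,2mk+1,mk}$ has vertex set $V(T_1)\cup V(T_2)\cup V(T_3)$ and edge set consisting of the edges of $T_1,T_2,T_3$, all edges from $V(T_1)$ to $V(T_3)$, all edges from $V(T_2)$ to $V(T_1)$, all edges from $V(T_2)$ to $V(T_3)$ except $(a_i,b_i)$ for $1\le i\le r$, and the edges $(b_i,a_i)$ for $1\le i\le r$. $\delta^+,\delta^-$ denote minimum out- and in-degree. -}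

module Defs where

open import Data.Nat using (ℕ; zero; suc; _+_; _*_; _∸_; _<_; _≤_; _<ᵇ_)
open import Data.Nat.DivMod using (_%_)
open import Data.Fin using (Fin; toℕ) renaming (zero to Fz; suc to Fs)
open import Data.Bool using (Bool; true; false; _∨_; if_then_else_)
open import Data.Product using (Σ; _×_; ∃-syntax)
open import Data.Unit using (⊤)
open import Data.Empty using (⊥)
open import Relation.Nullary using (¬_)
open import Relation.Binary.PropositionalEquality using (_≡_)
open import Function.Definitions using (Injective)

rr : ℕ → ℕ → ℕ
rr m k = m * k

NN : ℕ → ℕ → ℕ
NN m k = suc (2 * (m * k))

-- Vertex set of T_{2mk+1,2mk+1,mk}: disjoint union V(T1) ∪ V(T2) ∪ V(T3)
data Vtx (m k : ℕ) : Set where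
  v1 : Fin (rr m k) → Vtx m k
  v2 : Fin (NN m k) → Vtx m k
  v3 : Fin (NN m k) → Vtx m k

-- mk-th power of the directed N-cycle on Z_N:  x → y iff the distance
-- from x to y along the cycle, (y - x) mod N, lies in {1,…,mk}
CycEdge : (m k : ℕ) → Fin (NN m k) → Fin (NN m k) → Set
CycEdge m k x y =
  let d = (toℕ y + (NN m k ∸ toℕ x)) % NN m k in (1 ≤ d) × (d ≤ m * k)

-- The edge relation of T_{2mk+1,2mk+1,mk}.
--   ord : the transitive ordering of T1 (i → j iff ord i < ord j), injective
--   a, b : the distinguished vertices a_i ∈ V(T2), b_i ∈ V(T3)
Edge : (m k : ℕ) → (ord : Fin (rr m k) → ℕ)
     → (a b : Fin (rr m k) → Fin (NN m k)) → Vtx m k → Vtx m k → Set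
Edge m k ord a b (v1 i) (v1 j) = ord i < ord j
Edge m k ord a b (v1 i) (v2 y) = ⊥
Edge m k ord a b (v1 i) (v3 y) = ⊤
Edge m k ord a b (v2 x) (v1 j) = ⊤
Edge m k ord a b (v2 x) (v2 y) = CycEdge m k x y
Edge m k ord a b (v2 x) (v3 y) = ¬ (∃[ i ] (a i ≡ x × b i ≡ y))
Edge m k ord a b (v3 x) (v1 j) = ⊥
Edge m k ord a b (v3 x) (v2 y) = ∃[ i ] (a i ≡ y × b i ≡ x)
Edge m k ord a b (v3 x) (v3 y) = CycEdge m k x y

countFin : (n : ℕ) → (Fin n → Bool) → ℕ
countFin zero    P = 0
countFin (suc n) P = (if P Fz then 1 else 0) + countFin n (λ i → P (Fs i))

countV : (m k : ℕ) → (Vtx m k → Bool) → ℕ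
countV m k P = countFin (rr m k) (λ i → P (v1 i))
             + countFin (NN m k) (λ x → P (v2 x))
             + countFin (NN m k) (λ x → P (v3 x))

IsSpanningSubgraph : (m k : ℕ) → (ord : Fin (rr m k) → ℕ)
     → (a b : Fin (rr m k) → Fin (NN m k)) → (Vtx m k → Vtx m k → Bool) → Set
IsSpanningSubgraph m k ord a b D = ∀ u v → D u v ≡ true → Edge m k ord a b u v

outdeg : (m k : ℕ) → (Vtx m k → Vtx m k → Bool) → Vtx m k → ℕ
outdeg m k D u = countV m k (λ v → D u v)

indeg : (m k : ℕ) → (Vtx m k → Vtx m k → Bool) → Vtx m k → ℕ
indeg m k D v = countV m k (λ u → D u v)

-- Count the edges of D between the three parts T₁, T₂, T₃. A vertex of the transitive
-- tournament T₁ with i predecessors in T₁ needs at least k ∸ i in-neighbours in T₂, and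
-- at least t vertices of T₁ have fewer than t predecessors, so D has at least k(k+1)/2
-- edges from T₂ to T₁; symmetrically it has at least k(k+1)/2 edges from T₁ to T₃.
-- On the other hand, in-degrees are at least k while out-degrees are exactly k except at
-- surplus vertices (those of in- or out-degree > k), and the only edges entering T₂ from
-- outside are the at most mk edges bᵢaᵢ. Comparing the degree sums over T₂ gives
-- e(T₂,T₁) ≤ mk + (n - k)c₂ with n = 5mk + 2 and c₂ the number of surplus vertices in T₂,
-- and likewise e(T₁,T₃) ≤ mk + (n - k)c₃. Hence k(k+1) ≤ 2mk + (n - k)(c₂ + c₃), which
-- forces 5m(c₂ + c₃) + 2m ≥ k + 1.

module Submission where

open import Defs
open import Data.Nat using (ℕ; _+_; _*_; _≤_; _<ᵇ_)
open import Data.Fin using (Fin)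
open import Data.Bool using (Bool; _∨_)
open import Function.Definitions using (Injective)
open import Relation.Binary.PropositionalEquality using (_≡_)

open import Data.Nat using (zero; suc; _∸_; _<_; _<?_; z≤n; s≤s)
open import Data.Nat.Properties hiding (_≟_)
open import Data.Nat.Tactic.RingSolver using (solve-∀)
open import Data.Fin using () renaming (zero to Fz; suc to Fs)
open import Data.Fin.Properties using (_≟_)
open import Data.Bool using (true; false; T; _∧_; if_then_else_)
open import Data.Bool.Properties using (∨-conicalˡ; ∨-conicalʳ; T-∧; T-≡)
open import Function.Bundles using (Equivalence)
open import Data.Empty using (⊥; ⊥-elim)
open import Data.Product using (_×_; _,_; ∃-syntax)
open import Data.Unit using (tt)
open import Function using (_∘_; flip)
open import Relation.Binary.Core using (Rel)
open import Relation.Binary.Definitions using (Decidable; Transitive)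
open import Relation.Binary.PropositionalEquality
  using (refl; sym; trans; cong; cong₂; subst; module ≡-Reasoning)
open import Relation.Nullary using (¬_)
open import Relation.Nullary.Decidable using (⌊_⌋; toWitness; fromWitness; ⌊⌋-map′)
open import Level using (0ℓ)
open import Algebra.Properties.Semiring.Sum +-*-semiring
  using (sum-syntax; sum-cong-≗; sum-replicate-zero; ∑-comm; ∑-distrib-+; *-distribˡ-sum)
open import Algebra.Properties.CommutativeSemigroup +-commutativeSemigroup using (x∙yz≈yx∙z; xy∙z≈y∙xz)

-- Indicators, sums and counts

𝟙 : Bool → ℕ
𝟙 b = if b then 1 else 0

𝟙-mono : ∀ {p q} → (T p → T q) → 𝟙 p ≤ 𝟙 q
𝟙-mono {false} _ = z≤n
𝟙-mono {true} {true} _ = ≤-refl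
𝟙-mono {true} {false} p⇒q = ⊥-elim (p⇒q tt)

𝟙-mono-< : ∀ {p q} → ¬ T p → T q → 𝟙 p < 𝟙 q
𝟙-mono-< {true} ¬p _ = ⊥-elim (¬p tt)
𝟙-mono-< {false} {true} _ _ = s≤s z≤n

∑-mono-≤ : ∀ {n} {f g : Fin n → ℕ} → (∀ i → f i ≤ g i) → ∑[ i < n ] f i ≤ ∑[ i < n ] g i
∑-mono-≤ {zero} _ = z≤n
∑-mono-≤ {suc n} f≤g = +-mono-≤ (f≤g Fz) (∑-mono-≤ (f≤g ∘ Fs))

∑-const : ∀ n c → ∑[ i < n ] c ≡ n * c
∑-const zero c = refl
∑-const (suc n) c = cong (c +_) (∑-const n c)

∑-distrib-+₃ : ∀ {n} (f g h : Fin n → ℕ)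
  → ∑[ i < n ] (f i + g i + h i) ≡ ∑[ i < n ] f i + ∑[ i < n ] g i + ∑[ i < n ] h i
∑-distrib-+₃ {n} f g h =
  trans (∑-distrib-+ {n} (λ i → f i + g i) h) (cong (_+ ∑[ i < n ] h i) (∑-distrib-+ {n} f g))

countFin-sum : ∀ n (P : Fin n → Bool) → countFin n P ≡ ∑[ i < n ] 𝟙 (P i)
countFin-sum zero P = refl
countFin-sum (suc n) P = cong (𝟙 (P Fz) +_) (countFin-sum n (P ∘ Fs))

countFin-cong : ∀ n {P Q : Fin n → Bool} → (∀ i → P i ≡ Q i) → countFin n P ≡ countFin n Q
countFin-cong zero _ = refl
countFin-cong (suc n) P≡Q = cong₂ (λ p c → 𝟙 p + c) (P≡Q Fz) (countFin-cong n (P≡Q ∘ Fs))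

countFin-mono : ∀ n {P Q : Fin n → Bool} → (∀ i → T (P i) → T (Q i)) → countFin n P ≤ countFin n Q
countFin-mono zero _ = z≤n
countFin-mono (suc n) P⇒Q = +-mono-≤ (𝟙-mono (P⇒Q Fz)) (countFin-mono n (P⇒Q ∘ Fs))

countFin-mono-< : ∀ n {P Q : Fin n → Bool} → (∀ i → T (P i) → T (Q i))
  → ∀ w → ¬ T (P w) → T (Q w) → countFin n P < countFin n Q
countFin-mono-< (suc n) P⇒Q Fz ¬Pw Qw = +-mono-<-≤ (𝟙-mono-< ¬Pw Qw) (countFin-mono n (P⇒Q ∘ Fs))
countFin-mono-< (suc n) P⇒Q (Fs w) ¬Pw Qw =
  +-mono-≤-< (𝟙-mono (P⇒Q Fz)) (countFin-mono-< n (P⇒Q ∘ Fs) w ¬Pw Qw)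

countFin≤n : ∀ n (P : Fin n → Bool) → countFin n P ≤ n
countFin≤n zero _ = z≤n
countFin≤n (suc n) P = +-mono-≤ (𝟙-mono {q = true} _) (countFin≤n n (P ∘ Fs))

countFin-all : ∀ n {P : Fin n → Bool} → (∀ i → T (P i)) → n ≤ countFin n P
countFin-all zero _ = z≤n
countFin-all (suc n) {P} all = +-mono-≤ (𝟙-mono {true} {P Fz} (λ _ → all Fz)) (countFin-all n (all ∘ Fs))

countFin-none : ∀ n {P : Fin n → Bool} → (∀ i → ¬ T (P i)) → countFin n P ≡ 0
countFin-none zero _ = refl
countFin-none (suc n) {P} none with P Fz | none Fz
... | false | _ = countFin-none n (none ∘ Fs)
... | true | ¬true = ⊥-elim (¬true tt)

countFin-witness : ∀ n {P : Fin n → Bool} i → T (P i) → 1 ≤ countFin n P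
countFin-witness n i Pi = ≤-trans (s≤s z≤n) (countFin-mono-< n {P = λ _ → false} (λ _ ()) i (λ ()) Pi)

countFin-≟ : ∀ {n} (c : Fin n) → countFin n (λ y → ⌊ c ≟ y ⌋) ≡ 1
countFin-≟ {suc n} Fz = cong suc (countFin-none n (λ _ ()))
countFin-≟ {suc n} (Fs c) = trans (countFin-cong n (λ y → ⌊⌋-map′ _ _ (c ≟ y))) (countFin-≟ c)

countFin-comm : ∀ {p q} (R : Fin p → Fin q → Bool)
  → ∑[ x < p ] countFin q (R x) ≡ ∑[ y < q ] countFin p (λ x → R x y)
countFin-comm {p} {q} R = begin
    ∑[ x < p ] countFin q (R x)               ≡⟨ sum-cong-≗ (λ x → countFin-sum q (R x)) ⟩
    ∑[ x < p ] ∑[ y < q ] 𝟙 (R x y)           ≡⟨ ∑-comm (λ x y → 𝟙 (R x y)) ⟩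
    ∑[ y < q ] ∑[ x < p ] 𝟙 (R x y)           ≡⟨ sym (sum-cong-≗ (λ y → countFin-sum p (λ x → R x y))) ⟩
    ∑[ y < q ] countFin p (λ x → R x y)       ∎
  where open ≡-Reasoning

∑-countFin-fibres : ∀ {r q} (g : Fin r → Fin q) → ∑[ y < q ] countFin r (λ i → ⌊ g i ≟ y ⌋) ≡ r
∑-countFin-fibres {r} {q} g = begin
    ∑[ y < q ] countFin r (λ i → ⌊ g i ≟ y ⌋)  ≡⟨ sym (countFin-comm (λ i y → ⌊ g i ≟ y ⌋)) ⟩
    ∑[ i < r ] countFin q (λ y → ⌊ g i ≟ y ⌋)  ≡⟨ sum-cong-≗ (countFin-≟ ∘ g) ⟩
    ∑[ i < r ] 1                               ≡⟨ ∑-const r 1 ⟩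
    r * 1                                      ≡⟨ *-identityʳ r ⟩
    r                                          ∎
  where open ≡-Reasoning

countFin-image : ∀ {r q} {P : Fin q → Bool} {Q : Fin r → Bool} (g : Fin r → Fin q)
  → (∀ y → T (P y) → ∃[ i ] (T (Q i) × g i ≡ y)) → countFin q P ≤ countFin r Q
countFin-image {r} {q} {P} {Q} g covered = begin
    countFin q P                                    ≡⟨ countFin-sum q P ⟩
    ∑[ y < q ] 𝟙 (P y)                              ≤⟨ ∑-mono-≤ preimage ⟩
    ∑[ y < q ] countFin r (λ i → Q i ∧ ⌊ g i ≟ y ⌋)  ≡⟨ sym (countFin-comm (λ i y → Q i ∧ ⌊ g i ≟ y ⌋)) ⟩
    ∑[ i < r ] countFin q (λ y → Q i ∧ ⌊ g i ≟ y ⌋)  ≤⟨ ∑-mono-≤ image ⟩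
    ∑[ i < r ] 𝟙 (Q i)                              ≡⟨ sym (countFin-sum r Q) ⟩
    countFin r Q                                    ∎
  where
  open ≤-Reasoning
  preimage : ∀ y → 𝟙 (P y) ≤ countFin r (λ i → Q i ∧ ⌊ g i ≟ y ⌋)
  preimage y with P y | covered y
  ... | false | _ = z≤n
  ... | true | cov with cov tt
  ...   | i , Qi , gi≡y = countFin-witness r i (Equivalence.from T-∧ (Qi , fromWitness gi≡y))
  image : ∀ i → countFin q (λ y → Q i ∧ ⌊ g i ≟ y ⌋) ≤ 𝟙 (Q i)
  image i with Q i
  ... | true = ≤-reflexive (countFin-≟ (g i))
  ... | false = ≤-reflexive (countFin-none q (λ _ ()))

∑-countFin-mono : ∀ {p} (f g : Fin p → ℕ) (c d : ℕ) (B : Fin p → Bool)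
  → (∀ x → f x + c * 𝟙 (B x) ≤ g x + d * 𝟙 (B x))
  → ∑[ x < p ] f x + c * countFin p B ≤ ∑[ x < p ] g x + d * countFin p B
∑-countFin-mono {p} f g c d B f≤g = begin
    ∑[ x < p ] f x + c * countFin p B   ≡⟨ sym (weigh f c) ⟩
    ∑[ x < p ] (f x + c * 𝟙 (B x))      ≤⟨ ∑-mono-≤ f≤g ⟩
    ∑[ x < p ] (g x + d * 𝟙 (B x))      ≡⟨ weigh g d ⟩
    ∑[ x < p ] g x + d * countFin p B   ∎
  where
  open ≤-Reasoning
  weigh : ∀ h e → ∑[ x < p ] (h x + e * 𝟙 (B x)) ≡ ∑[ x < p ] h x + e * countFin p B
  weigh h e = trans (∑-distrib-+ {p} h _)
    (cong (∑[ x < p ] h x +_) (trans (sym (*-distribˡ-sum {p} e _)) (cong (e *_) (sym (countFin-sum p B)))))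

-- Ranks in a finite strict order

∸-suc : ∀ k r → suc k ∸ r ≡ (k ∸ r) + 𝟙 (r <ᵇ suc k)
∸-suc k zero = +-comm 1 k
∸-suc zero (suc r) = 0∸n≡0 r
∸-suc (suc k) (suc r) = ∸-suc k r

module Rank {n} (_≺_ : Rel (Fin n) 0ℓ) (_≺?_ : Decidable _≺_)
  (≺-irrefl : ∀ {i} → ¬ i ≺ i) (≺-trans : Transitive _≺_) where

  rank : Fin n → ℕ
  rank i = countFin n (λ j → ⌊ j ≺? i ⌋)

  rank-mono : ∀ {i j} → j ≺ i → rank j < rank i
  rank-mono {i} {j} j≺i = countFin-mono-< n
    (λ l l≺j → fromWitness (≺-trans (toWitness l≺j) j≺i)) j (≺-irrefl ∘ toWitness) (fromWitness j≺i)

  #rank< : ℕ → ℕ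
  #rank< t = countFin n (λ j → rank j <ᵇ t)

  -- Induction on b: every predecessor of i has smaller rank, hence rank below t, so rank i ≤ #rank< t.
  ranks-below : ∀ t → #rank< t < t → ∀ b i → rank i < b → rank i < t
  ranks-below t few (suc b) i (s≤s rank≤b) = ≤-<-trans
    (countFin-mono n (λ j j≺i → <⇒<ᵇ (ranks-below t few b j (<-≤-trans (rank-mono (toWitness j≺i)) rank≤b))))
    few

  t≤#rank< : ∀ t → t ≤ n → t ≤ #rank< t
  t≤#rank< t t≤n = ≮⇒≥ λ few →
    <-irrefl refl (<-≤-trans few (≤-trans t≤n
      (countFin-all n (λ i → <⇒<ᵇ (ranks-below t few (suc n) i (s≤s (countFin≤n n _)))))))

  ∑-suc∸rank : ∀ k → ∑[ i < n ] (suc k ∸ rank i) ≡ ∑[ i < n ] (k ∸ rank i) + #rank< (suc k)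
  ∑-suc∸rank k = begin
      ∑[ i < n ] (suc k ∸ rank i)                                 ≡⟨ sum-cong-≗ (∸-suc k ∘ rank) ⟩
      ∑[ i < n ] ((k ∸ rank i) + 𝟙 (rank i <ᵇ suc k))              ≡⟨ ∑-distrib-+ (λ i → k ∸ rank i) _ ⟩
      ∑[ i < n ] (k ∸ rank i) + ∑[ i < n ] 𝟙 (rank i <ᵇ suc k)     ≡⟨ cong (∑[ i < n ] (k ∸ rank i) +_) (sym (countFin-sum n _)) ⟩
      ∑[ i < n ] (k ∸ rank i) + #rank< (suc k)                    ∎
    where open ≡-Reasoning

  ∑-∸-rank : ∀ k → k ≤ n → k * suc k ≤ 2 * ∑[ i < n ] (k ∸ rank i)
  ∑-∸-rank zero _ = z≤n
  ∑-∸-rank (suc k) k<n = begin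
      suc k * suc (suc k)                                 ≡⟨ expand k ⟩
      k * suc k + 2 * suc k                               ≤⟨ +-mono-≤ (∑-∸-rank k (<⇒≤ k<n)) (*-monoʳ-≤ 2 (t≤#rank< (suc k) k<n)) ⟩
      2 * ∑[ i < n ] (k ∸ rank i) + 2 * #rank< (suc k)     ≡⟨ sym (*-distribˡ-+ 2 (∑[ i < n ] (k ∸ rank i)) _) ⟩
      2 * (∑[ i < n ] (k ∸ rank i) + #rank< (suc k))       ≡⟨ cong (2 *_) (sym (∑-suc∸rank k)) ⟩
      2 * ∑[ i < n ] (suc k ∸ rank i)                      ∎
    where
    open ≤-Reasoning
    expand : ∀ k → suc k * suc (suc k) ≡ k * suc k + 2 * suc k
    expand = solve-∀

<ᵇ≡false⇒≥ : ∀ {x y} → (x <ᵇ y) ≡ false → y ≤ x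
<ᵇ≡false⇒≥ x<ᵇy≡false = ≮⇒≥ (λ x<y → subst T x<ᵇy≡false (<⇒<ᵇ x<y))

excess-trade : ∀ {x y k n} b → (b ≡ false → x ≤ k) → k ≤ y → x ≤ n → x + k * 𝟙 b ≤ y + n * 𝟙 b
excess-trade {x} {y} {k} {n} true _ k≤y x≤n rewrite *-identityʳ k | *-identityʳ n =
  ≤-trans (+-mono-≤ x≤n k≤y) (≤-reflexive (+-comm n y))
excess-trade {x} {y} {k} {n} false x≤k k≤y _ rewrite *-zeroʳ k | *-zeroʳ n | +-identityʳ x | +-identityʳ y =
  ≤-trans (x≤k refl) k≤y

k≤m*k : ∀ {m} k → 1 ≤ m → k ≤ m * k
k≤m*k k (s≤s _) = m≤m+n k _

degree-bound : ∀ {m k C} → 1 ≤ m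
  → k * suc k + k * C ≤ 2 * (m * k) + (5 * (m * k) + 2) * C → k + 1 ≤ 5 * m * C + 2 * m
degree-bound {m} {zero} {C} 1≤m _ = ≤-trans 1≤m (≤-trans (m≤m+n m _) (m≤n+m (2 * m) (5 * m * C)))
degree-bound {m} {suc zero} {C} 1≤m _ = ≤-trans (*-monoʳ-≤ 2 1≤m) (m≤n+m (2 * m) (5 * m * C))
degree-bound {m} {k@(suc (suc j))} {C} _ hyp =
  ≮⇒≥ (refute ∘ m<1+n⇒m≤n ∘ subst (5 * m * C + 2 * m <_) (+-comm k 1))
  where
  open ≤-Reasoning
  reorder : ∀ k C → k * k + (k + k * C) ≡ k * suc k + k * C
  reorder = solve-∀
  collect : ∀ m k C → 2 * (m * k) + (5 * (m * k) + 2) * C ≡ k * (5 * m * C + 2 * m) + 2 * C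
  collect = solve-∀
  refute : 5 * m * C + 2 * m ≤ k → ⊥
  refute X≤k = <-irrefl refl (begin-strict
    2 * C                   <⟨ m<n+m (2 * C) {2} (s≤s z≤n) ⟩
    2 + 2 * C               ≡⟨ *-suc 2 C ⟨
    2 * suc C               ≤⟨ *-monoˡ-≤ (suc C) {2} {k} (s≤s (s≤s z≤n)) ⟩
    k * suc C               ≡⟨ *-suc k C ⟩
    k + k * C               ≤⟨ +-cancelˡ-≤ (k * k) _ _ (begin
      k * k + (k + k * C)                 ≡⟨ reorder k C ⟩
      k * suc k + k * C                   ≤⟨ hyp ⟩
      2 * (m * k) + (5 * (m * k) + 2) * C ≡⟨ collect m k C ⟩
      k * (5 * m * C + 2 * m) + 2 * C     ≤⟨ +-monoˡ-≤ (2 * C) (*-monoʳ-≤ k X≤k) ⟩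
      k * k + 2 * C                       ∎) ⟩
    2 * C                   ∎)

-- Edge counts of a spanning subgraph of T_{2mk+1,2mk+1,mk}

module EdgeCounts (m k : ℕ) (ord : Fin (rr m k) → ℕ) (a b : Fin (rr m k) → Fin (NN m k))
  (D : Vtx m k → Vtx m k → Bool) (D⊆T : IsSpanningSubgraph m k ord a b D)
  (k≤out : ∀ u → k ≤ outdeg m k D u) (k≤in : ∀ u → k ≤ indeg m k D u) where

  order : ℕ
  order = rr m k + NN m k + NN m k

  order≡ : order ≡ 5 * (m * k) + 2
  order≡ = normalise m k
    where
    normalise : ∀ m k → m * k + suc (2 * (m * k)) + suc (2 * (m * k)) ≡ 5 * (m * k) + 2
    normalise = solve-∀

  edge : ∀ {u v} → T (D u v) → Edge m k ord a b u v
  edge = D⊆T _ _ ∘ Equivalence.to T-≡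

  out[_] : ∀ {q} → (Fin q → Vtx m k) → Vtx m k → ℕ
  out[_] {q} Y u = countFin q (λ y → D u (Y y))

  in[_] : ∀ {p} → (Fin p → Vtx m k) → Vtx m k → ℕ
  in[_] {p} X v = countFin p (λ x → D (X x) v)

  e[_,_] : ∀ {p q} → (Fin p → Vtx m k) → (Fin q → Vtx m k) → ℕ
  e[_,_] {p} X Y = ∑[ x < p ] out[ Y ] (X x)

  e-by-in : ∀ {p q} (X : Fin p → Vtx m k) (Y : Fin q → Vtx m k) → e[ X , Y ] ≡ ∑[ y < q ] in[ X ] (Y y)
  e-by-in X Y = countFin-comm (λ x y → D (X x) (Y y))

  out-none : ∀ {q} (Y : Fin q → Vtx m k) u → (∀ y → ¬ Edge m k ord a b u (Y y)) → out[ Y ] u ≡ 0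
  out-none {q} Y u ¬E = countFin-none q (λ y → ¬E y ∘ edge)

  in-none : ∀ {p} (X : Fin p → Vtx m k) v → (∀ x → ¬ Edge m k ord a b (X x) v) → in[ X ] v ≡ 0
  in-none {p} X v ¬E = countFin-none p (λ x → ¬E x ∘ edge)

  e-none : ∀ {p q} (X : Fin p → Vtx m k) (Y : Fin q → Vtx m k)
    → (∀ x y → ¬ Edge m k ord a b (X x) (Y y)) → e[ X , Y ] ≡ 0
  e-none {p} X Y ¬E = trans (sum-cong-≗ (λ x → out-none Y (X x) (¬E x))) (sum-replicate-zero p)

  ∑-outdeg : ∀ {p} (X : Fin p → Vtx m k) → ∑[ x < p ] outdeg m k D (X x) ≡ e[ X , v1 ] + e[ X , v2 ] + e[ X , v3 ]
  ∑-outdeg X = ∑-distrib-+₃ (out[ v1 ] ∘ X) (out[ v2 ] ∘ X) (out[ v3 ] ∘ X)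

  ∑-indeg : ∀ {q} (Y : Fin q → Vtx m k) → ∑[ y < q ] indeg m k D (Y y) ≡ e[ v1 , Y ] + e[ v2 , Y ] + e[ v3 , Y ]
  ∑-indeg Y = trans (∑-distrib-+₃ (in[ v1 ] ∘ Y) (in[ v2 ] ∘ Y) (in[ v3 ] ∘ Y))
    (sym (cong₂ _+_ (cong₂ _+_ (e-by-in v1 Y) (e-by-in v2 Y)) (e-by-in v3 Y)))

  surplus : Vtx m k → Bool
  surplus u = (k <ᵇ outdeg m k D u) ∨ (k <ᵇ indeg m k D u)

  #surplus : ∀ {p} → (Fin p → Vtx m k) → ℕ
  #surplus {p} X = countFin p (surplus ∘ X)

  out[]≤ : ∀ {q} (Y : Fin q → Vtx m k) u → out[ Y ] u ≤ q
  out[]≤ {q} Y u = countFin≤n q (λ y → D u (Y y))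

  in[]≤ : ∀ {p} (X : Fin p → Vtx m k) v → in[ X ] v ≤ p
  in[]≤ {p} X v = countFin≤n p (λ x → D (X x) v)

  outdeg≤order : ∀ u → outdeg m k D u ≤ order
  outdeg≤order u = +-mono-≤ (+-mono-≤ (out[]≤ v1 u) (out[]≤ v2 u)) (out[]≤ v3 u)

  indeg≤order : ∀ v → indeg m k D v ≤ order
  indeg≤order v = +-mono-≤ (+-mono-≤ (in[]≤ v1 v) (in[]≤ v2 v)) (in[]≤ v3 v)

  ∑-outdeg-excess : ∀ {p} (X : Fin p → Vtx m k)
    → ∑[ x < p ] outdeg m k D (X x) + k * #surplus X ≤ ∑[ x < p ] indeg m k D (X x) + order * #surplus X
  ∑-outdeg-excess X = ∑-countFin-mono (outdeg m k D ∘ X) (indeg m k D ∘ X) k order (surplus ∘ X) λ x →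
    excess-trade (surplus (X x)) (<ᵇ≡false⇒≥ ∘ ∨-conicalˡ _ _) (k≤in (X x)) (outdeg≤order (X x))

  ∑-indeg-excess : ∀ {p} (X : Fin p → Vtx m k)
    → ∑[ x < p ] indeg m k D (X x) + k * #surplus X ≤ ∑[ x < p ] outdeg m k D (X x) + order * #surplus X
  ∑-indeg-excess X = ∑-countFin-mono (indeg m k D ∘ X) (outdeg m k D ∘ X) k order (surplus ∘ X) λ x →
    excess-trade (surplus (X x)) (<ᵇ≡false⇒≥ ∘ ∨-conicalʳ _ _) (k≤out (X x)) (indeg≤order (X x))

  T2-excess : e[ v2 , v1 ] + k * #surplus v2 ≤ e[ v3 , v2 ] + order * #surplus v2
  T2-excess = +-cancelˡ-≤ e[ v2 , v2 ] _ _ (begin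
      e[ v2 , v2 ] + (e[ v2 , v1 ] + k * c)                    ≡⟨ x∙yz≈yx∙z e[ v2 , v2 ] e[ v2 , v1 ] (k * c) ⟩
      e[ v2 , v1 ] + e[ v2 , v2 ] + k * c                      ≤⟨ +-monoˡ-≤ (k * c) (m≤m+n (e[ v2 , v1 ] + e[ v2 , v2 ]) e[ v2 , v3 ]) ⟩
      e[ v2 , v1 ] + e[ v2 , v2 ] + e[ v2 , v3 ] + k * c       ≡⟨ cong (_+ k * c) (∑-outdeg v2) ⟨
      ∑[ x < NN m k ] outdeg m k D (v2 x) + k * c              ≤⟨ ∑-outdeg-excess v2 ⟩
      ∑[ x < NN m k ] indeg m k D (v2 x) + order * c           ≡⟨ cong (_+ order * c) (∑-indeg v2) ⟩
      e[ v1 , v2 ] + e[ v2 , v2 ] + e[ v3 , v2 ] + order * c   ≡⟨ cong (λ e → e + e[ v2 , v2 ] + e[ v3 , v2 ] + order * c) (e-none v1 v2 (λ _ _ ())) ⟩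
      e[ v2 , v2 ] + e[ v3 , v2 ] + order * c                  ≡⟨ +-assoc e[ v2 , v2 ] _ _ ⟩
      e[ v2 , v2 ] + (e[ v3 , v2 ] + order * c)                ∎)
    where
    open ≤-Reasoning
    c = #surplus v2

  T3-excess : e[ v1 , v3 ] + k * #surplus v3 ≤ e[ v3 , v2 ] + order * #surplus v3
  T3-excess = +-cancelˡ-≤ e[ v3 , v3 ] _ _ (begin
      e[ v3 , v3 ] + (e[ v1 , v3 ] + k * c)                    ≡⟨ x∙yz≈yx∙z e[ v3 , v3 ] e[ v1 , v3 ] (k * c) ⟩
      e[ v1 , v3 ] + e[ v3 , v3 ] + k * c                      ≤⟨ +-monoˡ-≤ (k * c) (+-monoˡ-≤ e[ v3 , v3 ] (m≤m+n e[ v1 , v3 ] e[ v2 , v3 ])) ⟩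
      e[ v1 , v3 ] + e[ v2 , v3 ] + e[ v3 , v3 ] + k * c       ≡⟨ cong (_+ k * c) (∑-indeg v3) ⟨
      ∑[ x < NN m k ] indeg m k D (v3 x) + k * c               ≤⟨ ∑-indeg-excess v3 ⟩
      ∑[ x < NN m k ] outdeg m k D (v3 x) + order * c          ≡⟨ cong (_+ order * c) (∑-outdeg v3) ⟩
      e[ v3 , v1 ] + e[ v3 , v2 ] + e[ v3 , v3 ] + order * c   ≡⟨ cong (λ e → e + e[ v3 , v2 ] + e[ v3 , v3 ] + order * c) (e-none v3 v1 (λ _ _ ())) ⟩
      e[ v3 , v2 ] + e[ v3 , v3 ] + order * c                  ≡⟨ xy∙z≈y∙xz e[ v3 , v2 ] e[ v3 , v3 ] (order * c) ⟩
      e[ v3 , v3 ] + (e[ v3 , v2 ] + order * c)                ∎)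
    where
    open ≤-Reasoning
    c = #surplus v3

  module Predecessors = Rank (λ i j → ord i < ord j) (λ i j → ord i <? ord j) (<-irrefl refl) <-trans
  module Successors = Rank (λ i j → ord j < ord i) (λ i j → ord j <? ord i) (<-irrefl refl) (flip <-trans)

  T1-in : k ≤ rr m k → k * suc k ≤ 2 * e[ v2 , v1 ]
  T1-in k≤r = ≤-trans (Predecessors.∑-∸-rank k k≤r) (*-monoʳ-≤ 2 (begin
      ∑[ i < rr m k ] (k ∸ Predecessors.rank i)  ≤⟨ ∑-mono-≤ missing ⟩
      ∑[ i < rr m k ] in[ v2 ] (v1 i)            ≡⟨ e-by-in v2 v1 ⟨
      e[ v2 , v1 ]                               ∎))
    where
    open ≤-Reasoning
    missing : ∀ i → k ∸ Predecessors.rank i ≤ in[ v2 ] (v1 i)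
    missing i = m≤n+o⇒m∸n≤o k (Predecessors.rank i) (begin
        k                                                     ≤⟨ k≤in (v1 i) ⟩
        in[ v1 ] (v1 i) + in[ v2 ] (v1 i) + in[ v3 ] (v1 i)   ≡⟨ cong (in[ v1 ] (v1 i) + in[ v2 ] (v1 i) +_) (in-none v3 (v1 i) (λ _ ())) ⟩
        in[ v1 ] (v1 i) + in[ v2 ] (v1 i) + 0                 ≡⟨ +-identityʳ _ ⟩
        in[ v1 ] (v1 i) + in[ v2 ] (v1 i)                     ≤⟨ +-monoˡ-≤ (in[ v2 ] (v1 i)) (countFin-mono (rr m k) (λ j → fromWitness ∘ edge)) ⟩
        Predecessors.rank i + in[ v2 ] (v1 i)                 ∎)

  T1-out : k ≤ rr m k → k * suc k ≤ 2 * e[ v1 , v3 ]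
  T1-out k≤r = ≤-trans (Successors.∑-∸-rank k k≤r) (*-monoʳ-≤ 2 (∑-mono-≤ missing))
    where
    open ≤-Reasoning
    missing : ∀ i → k ∸ Successors.rank i ≤ out[ v3 ] (v1 i)
    missing i = m≤n+o⇒m∸n≤o k (Successors.rank i) (begin
        k                                                        ≤⟨ k≤out (v1 i) ⟩
        out[ v1 ] (v1 i) + out[ v2 ] (v1 i) + out[ v3 ] (v1 i)   ≡⟨ cong (λ o → out[ v1 ] (v1 i) + o + out[ v3 ] (v1 i)) (out-none v2 (v1 i) (λ _ ())) ⟩
        out[ v1 ] (v1 i) + 0 + out[ v3 ] (v1 i)                  ≡⟨ cong (_+ out[ v3 ] (v1 i)) (+-identityʳ (out[ v1 ] (v1 i))) ⟩
        out[ v1 ] (v1 i) + out[ v3 ] (v1 i)                      ≤⟨ +-monoˡ-≤ (out[ v3 ] (v1 i)) (countFin-mono (rr m k) (λ j → fromWitness ∘ edge)) ⟩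
        Successors.rank i + out[ v3 ] (v1 i)                     ∎)

  e[v3,v2]≤r : e[ v3 , v2 ] ≤ rr m k
  e[v3,v2]≤r = begin
      e[ v3 , v2 ]                                        ≤⟨ ∑-mono-≤ (λ y → countFin-image a (covered y)) ⟩
      ∑[ y < NN m k ] countFin (rr m k) (λ i → ⌊ b i ≟ y ⌋) ≡⟨ ∑-countFin-fibres b ⟩
      rr m k                                              ∎
    where
    open ≤-Reasoning
    covered : ∀ y x → T (D (v3 y) (v2 x)) → ∃[ i ] (T ⌊ b i ≟ y ⌋ × a i ≡ x)
    covered y x Dyx with edge Dyx
    ... | i , ai≡x , bi≡y = i , fromWitness bi≡y , ai≡x

  edge-count-bound : k ≤ rr m k
    → k * suc k + k * (#surplus v2 + #surplus v3) ≤ 2 * (m * k) + (5 * (m * k) + 2) * (#surplus v2 + #surplus v3)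
  edge-count-bound k≤r = begin
      k * suc k + k * (c₂ + c₃)                                   ≤⟨ +-monoˡ-≤ (k * (c₂ + c₃)) K≤ ⟩
      e[ v2 , v1 ] + e[ v1 , v3 ] + k * (c₂ + c₃)                 ≡⟨ split e[ v2 , v1 ] e[ v1 , v3 ] k c₂ c₃ ⟩
      (e[ v2 , v1 ] + k * c₂) + (e[ v1 , v3 ] + k * c₃)           ≤⟨ +-mono-≤ T2-excess T3-excess ⟩
      (e[ v3 , v2 ] + order * c₂) + (e[ v3 , v2 ] + order * c₃)   ≡⟨ merge e[ v3 , v2 ] order c₂ c₃ ⟩
      2 * e[ v3 , v2 ] + order * (c₂ + c₃)                        ≤⟨ +-mono-≤ (*-monoʳ-≤ 2 e[v3,v2]≤r) (≤-reflexive (cong (_* (c₂ + c₃)) order≡)) ⟩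
      2 * (m * k) + (5 * (m * k) + 2) * (c₂ + c₃)                 ∎
    where
    open ≤-Reasoning
    c₂ = #surplus v2
    c₃ = #surplus v3
    K≤ : k * suc k ≤ e[ v2 , v1 ] + e[ v1 , v3 ]
    K≤ = *-cancelˡ-≤ 2 (begin
        2 * (k * suc k)                       ≡⟨ cong (k * suc k +_) (+-identityʳ _) ⟩
        k * suc k + k * suc k                 ≤⟨ +-mono-≤ (T1-in k≤r) (T1-out k≤r) ⟩
        2 * e[ v2 , v1 ] + 2 * e[ v1 , v3 ]   ≡⟨ *-distribˡ-+ 2 e[ v2 , v1 ] e[ v1 , v3 ] ⟨
        2 * (e[ v2 , v1 ] + e[ v1 , v3 ])     ∎)
    split : ∀ a b k c d → a + b + k * (c + d) ≡ (a + k * c) + (b + k * d)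
    split = solve-∀
    merge : ∀ e n c d → (e + n * c) + (e + n * d) ≡ 2 * e + n * (c + d)
    merge = solve-∀

lemma7p3 : (m k : ℕ) → 1 ≤ m → 1 ≤ k
    → (ord : Fin (rr m k) → ℕ) → Injective _≡_ _≡_ ord
    → (a b : Fin (rr m k) → Fin (NN m k))
    → Injective _≡_ _≡_ a → Injective _≡_ _≡_ b
    → (D : Vtx m k → Vtx m k → Bool)
    → IsSpanningSubgraph m k ord a b D
    → (∀ u → k ≤ outdeg m k D u)
    → (∀ u → k ≤ indeg m k D u)
    → k + 1 ≤ 5 * m * countV m k (λ u → (k <ᵇ outdeg m k D u) ∨ (k <ᵇ indeg m k D u)) + 2 * m
lemma7p3 m k 1≤m _ ord _ a b _ _ D D⊆T k≤out k≤in =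
  ≤-trans (degree-bound 1≤m (edge-count-bound (k≤m*k k 1≤m)))
    (+-monoˡ-≤ (2 * m) (*-monoʳ-≤ (5 * m) (+-monoˡ-≤ (#surplus v3) (m≤n+m (#surplus v2) (#surplus v1)))))
  where open EdgeCounts m k ord a b D D⊆T k≤out k≤in
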